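{- Let $G_1,G_2$ be looped simple graphs and suppose $\beta:M(IAS(G_1))\to M(IAS(G_2))$ is a compatible isomorphism determined by the map $f:V(G_1)\to S_3$ with $f(v)=1$ for all $v\in V(G_1)$. Then $G_1$ and $G_2$ are isomorphic.
   Context: A looped simple graph is a finite graph in which each vertex may carry at most one loop and distinct non-loop edges join distinct pairs of vertices. $A(G)$ is its adjacency matrix over $GF(2)$ (diagonal entry $1$ iff looped). $M(IAS(G))$ is the binary matroid represented by the columns of $(I\mid A(G)\mid I+A(G))$ over $GF(2)$; its ground set $W(G)$ consists of columns $v_\phi,v_\chi,v_\psi$, the columns of $v$ in $I$, $A(G)$, $I+A(G)$. $S_3$ is the permutation group of $\{\phi,\chi,\psi\}$ with identity $1$. A compatible isomorphism $\beta$ is a matroid isomorphism mapping each cell $\{v_\phi,v_\chi,v_\psi\}$ onto a cell $\{w_\phi,w_\chi,w_\psi\}$; it induces a bijection $\beta:V(G_1)\to V(G_2)$ and $f_\beta:V(G_1)\to S_3$ with $\beta(v_\iota)=\beta(v)_{f_\beta(v)(\iota)}$; $\beta$ is determined by $f_\beta$. -}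

module Defs where

open import Data.Nat using (ℕ)
open import Data.Bool using (Bool; true; false; _xor_; if_then_else_)
open import Data.Fin using (Fin; zero; suc; _≟_)
open import Data.Product using (_×_; _,_; Σ; ∃-syntax)
open import Data.List using (List; foldr; allFin; cartesianProduct)
open import Relation.Nullary using (does)
open import Relation.Binary.PropositionalEquality using (_≡_)
open import Function.Bundles using (_↔_; Inverse; _⇔_)
open import Data.Fin.Permutation using (Permutation′; _⟨$⟩ʳ_)

-- A looped simple graph on vertex set Fin n is given by its adjacency
-- matrix over GF(2) = Bool (xor as addition): symmetric, diagonal = loops.
record LoopedSimpleGraph (n : ℕ) : Set where
  field
    adj : Fin n → Fin n → Bool
    sym : ∀ i j → adj i j ≡ adj j i
open LoopedSimpleGraph public

Vec2 : ℕ → Set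
Vec2 n = Fin n → Bool

zeroV : ∀ {n} → Vec2 n
zeroV _ = false

_⊕_ : ∀ {n} → Vec2 n → Vec2 n → Vec2 n
(x ⊕ y) i = x i xor y i

-- Cell labels: zero = φ (column of I), 1 = χ (column of A), 2 = ψ (column of I + A)
Label : Set
Label = Fin 3

W : ℕ → Set
W n = Fin n × Label

allW : (n : ℕ) → List (W n)
allW n = cartesianProduct (allFin n) (allFin 3)

δ : ∀ {n} → Fin n → Vec2 n
δ v u = does (u ≟ v)

-- The column of (I | A(G) | I + A(G)) indexed by an element of W(G)
column : ∀ {n} → LoopedSimpleGraph n → W n → Vec2 n
column G (v , zero) = δ v
column G (v , suc zero) = λ u → adj G u v
column G (v , suc (suc zero)) = δ v ⊕ (λ u → adj G u v)

Subset : Set → Set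
Subset X = X → Bool

_⊆_ : ∀ {X : Set} → Subset X → Subset X → Set
T ⊆ S = ∀ x → T x ≡ true → S x ≡ true

colSum : ∀ {n} → LoopedSimpleGraph n → Subset (W n) → Vec2 n
colSum {n} G T = foldr (λ w acc → (if T w then column G w else zeroV) ⊕ acc) zeroV (allW n)

Independent : ∀ {n} → LoopedSimpleGraph n → Subset (W n) → Set
Independent G S =
  ∀ (T : Subset _) → T ⊆ S → (∀ u → colSum G T u ≡ false) → ∀ w → T w ≡ false

IsMatroidIso : ∀ {n₁ n₂} → LoopedSimpleGraph n₁ → LoopedSimpleGraph n₂ →
               (W n₁ ↔ W n₂) → Set
IsMatroidIso G₁ G₂ β =
  ∀ (S : Subset _) → Independent G₁ S ⇔ Independent G₂ (λ w → S (Inverse.from β w))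

S₃ : Set
S₃ = Permutation′ 3

IsCompatibleWith : ∀ {n₁ n₂} → (W n₁ ↔ W n₂) → (Fin n₁ → Fin n₂) → (Fin n₁ → S₃) → Set
IsCompatibleWith β σ f = ∀ v ι → Inverse.to β (v , ι) ≡ (σ v , f v ⟨$⟩ʳ ι)

Isomorphic : ∀ {n₁ n₂} → LoopedSimpleGraph n₁ → LoopedSimpleGraph n₂ → Set
Isomorphic {n₁} {n₂} G₁ G₂ =
  Σ (Fin n₁ ↔ Fin n₂) λ τ → ∀ i j → adj G₁ i j ≡ adj G₂ (Inverse.to τ i) (Inverse.to τ j)

-- For vertices i, j consider the set {v_φ : v ≠ i} ∪ {j_χ}: the columns e_v (v ≠ i) span
-- every vector vanishing at i, so adding the column of j in A keeps it independent exactly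
-- when that column is nonzero at i, i.e. when i and j are adjacent. If f is the identity,
-- β maps this set for G₁ onto the corresponding set for G₂, so β's vertex map preserves
-- adjacency.
module Submission where

open import Defs hiding (sym)
open import Data.Nat using (ℕ; zero; suc)
open import Data.Fin using (Fin; zero; suc; _≟_; punchIn)
open import Data.Fin.Properties using (punchInᵢ≢i)
open import Data.Fin.Permutation using (_⟨$⟩ʳ_)
open import Data.Bool using (Bool; true; false; not; _∧_; _xor_; if_then_else_)
open import Data.Bool.Properties
  using (xor-∧-commutativeRing; xor-assoc; xor-same; xor-identityʳ; ∧-zeroʳ; ∧-identityʳ; ⇔→≡)
open import Data.Product using (_,_; proj₁; proj₂)
open import Data.List using (List; []; _∷_; _++_; foldr; map; tabulate; allFin; cartesianProduct)
open import Data.List.Properties using (foldr-fusion)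
open import Data.Empty using (⊥-elim)
open import Function using (_∘_; id)
open import Function.Definitions using (Injective)
open import Function.Bundles using (_↔_; _⇔_; Inverse; mk⇔; mk↔ₛ′)
import Function.Properties.Equivalence as ⇔
open import Relation.Nullary using (¬_; does; yes; no; contradiction)
open import Relation.Nullary.Decidable using (dec-true; dec-false)
open import Relation.Binary.PropositionalEquality
  using (_≡_; _≢_; _≗_; refl; sym; trans; cong; module ≡-Reasoning)
open import Algebra.Bundles using (CommutativeRing)
open import Algebra.Properties.CommutativeMonoid.Sum
  (CommutativeRing.+-commutativeMonoid xor-∧-commutativeRing)
  using (sum; sum-syntax; sum-cong-≗; ∑-distrib-+; sum-remove; sum-replicate-zero)

pattern φ = zero
pattern χ = suc zero
pattern ψ = suc (suc zero)

xorSum : ∀ {A : Set} → (A → Bool) → List A → Bool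
xorSum h = foldr (λ x b → h x xor b) false

xorSum-++ : ∀ {A : Set} (h : A → Bool) xs ys →
            xorSum h (xs ++ ys) ≡ xorSum h xs xor xorSum h ys
xorSum-++ h []       ys = refl
xorSum-++ h (x ∷ xs) ys =
  trans (cong (h x xor_) (xorSum-++ h xs ys)) (sym (xor-assoc (h x) _ _))

xorSum-allW : ∀ {n} (h : W n → Bool) → xorSum h (allW n) ≡ ∑[ v < n ] ∑[ ι < 3 ] h (v , ι)
xorSum-allW {n} h = go n id
  where
  go : ∀ m (g : Fin m → Fin n) →
       xorSum h (cartesianProduct (tabulate g) (allFin 3)) ≡ ∑[ v < m ] ∑[ ι < 3 ] h (g v , ι)
  go zero    g = refl
  go (suc m) g =
    trans (xorSum-++ h (map (g zero ,_) (allFin 3)) (cartesianProduct (tabulate (g ∘ suc)) (allFin 3)))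
          (cong (∑[ ι < 3 ] h (g zero , ι) xor_) (go m (g ∘ suc)))

sum-supported : ∀ {n} (a : Fin n → Bool) j → (∀ v → v ≢ j → a v ≡ false) → sum a ≡ a j
sum-supported {suc n} a j outside = begin
  sum a                           ≡⟨ sum-remove a ⟩
  a j xor sum (a ∘ punchIn j)    ≡⟨ cong (a j xor_) (trans (sum-cong-≗ vanish) (sum-replicate-zero n)) ⟩
  a j xor false                   ≡⟨ xor-identityʳ (a j) ⟩
  a j                             ∎
  where
  open ≡-Reasoning
  vanish : ∀ k → a (punchIn j k) ≡ false
  vanish k = outside (punchIn j k) (punchInᵢ≢i j k)

δ-self : ∀ {n} (u : Fin n) → δ u u ≡ true
δ-self u = dec-true (u ≟ u) refl

δ-other : ∀ {n} {u v : Fin n} → v ≢ u → δ v u ≡ false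
δ-other v≢u = dec-false (_ ≟ _) (v≢u ∘ sym)

colSum-apply : ∀ {n} (G : LoopedSimpleGraph n) T u →
               colSum G T u ≡ ∑[ v < n ] ∑[ ι < 3 ] (T (v , ι) ∧ column G (v , ι) u)
colSum-apply {n} G T u = trans
  (foldr-fusion (λ x → x u) zeroV (λ w acc → cong (_xor acc u) (selected w)) (allW n))
  (xorSum-allW (λ w → T w ∧ column G w u))
  where
  selected : ∀ w → (if T w then column G w else zeroV) u ≡ T w ∧ column G w u
  selected w with T w
  ... | true  = refl
  ... | false = refl

colSum-without-ψ : ∀ {n} (G : LoopedSimpleGraph n) T → (∀ v → T (v , ψ) ≡ false) →
                   ∀ u → colSum G T u ≡ T (u , φ) xor ∑[ v < n ] (T (v , χ) ∧ adj G u v)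
colSum-without-ψ {n} G T noψ u = begin
  colSum G T u                                              ≡⟨ colSum-apply G T u ⟩
  ∑[ v < n ] ∑[ ι < 3 ] (T (v , ι) ∧ column G (v , ι) u)    ≡⟨ sum-cong-≗ dropψ ⟩
  ∑[ v < n ] (T (v , φ) ∧ δ v u xor T (v , χ) ∧ adj G u v)  ≡⟨ ∑-distrib-+ (λ v → T (v , φ) ∧ δ v u) _ ⟩
  ∑[ v < n ] (T (v , φ) ∧ δ v u) xor χ-part                 ≡⟨ cong (_xor χ-part) (sum-supported _ u φ-outside) ⟩
  T (u , φ) ∧ δ u u xor χ-part                              ≡⟨ cong (λ b → T (u , φ) ∧ b xor χ-part) (δ-self u) ⟩
  T (u , φ) ∧ true xor χ-part                               ≡⟨ cong (_xor χ-part) (∧-identityʳ (T (u , φ))) ⟩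
  T (u , φ) xor χ-part                                      ∎
  where
  open ≡-Reasoning
  χ-part : Bool
  χ-part = ∑[ v < n ] (T (v , χ) ∧ adj G u v)
  φ-outside : ∀ v → v ≢ u → T (v , φ) ∧ δ v u ≡ false
  φ-outside v v≢u = trans (cong (T (v , φ) ∧_) (δ-other v≢u)) (∧-zeroʳ _)
  dropψ : ∀ v → ∑[ ι < 3 ] (T (v , ι) ∧ column G (v , ι) u)
                ≡ (T (v , φ) ∧ δ v u xor T (v , χ) ∧ adj G u v)
  dropψ v rewrite noψ v = cong (T (v , φ) ∧ δ v u xor_) (xor-identityʳ _)

⊆-false : ∀ {X : Set} {T S : Subset X} → T ⊆ S → ∀ x → S x ≡ false → T x ≡ false
⊆-false {T = T} T⊆S x Sx≡false with T x in Tx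
... | false = refl
... | true  = trans (sym (T⊆S x Tx)) Sx≡false

Independent-anti : ∀ {n} (G : LoopedSimpleGraph n) {S S′ : Subset (W n)} →
                   S′ ⊆ S → Independent G S → Independent G S′
Independent-anti G S′⊆S indS T T⊆S′ = indS T (λ w → S′⊆S w ∘ T⊆S′ w)

Independent-cong : ∀ {n} (G : LoopedSimpleGraph n) {S S′ : Subset (W n)} →
                   S ≗ S′ → Independent G S ⇔ Independent G S′
Independent-cong G S≗S′ = mk⇔
  (Independent-anti G (λ w S′w → trans (S≗S′ w) S′w))
  (Independent-anti G (λ w Sw → trans (sym (S≗S′ w)) Sw))

exchange : ∀ {n} → Fin n → Fin n → Subset (W n)
exchange i j (v , φ) = not (does (v ≟ i))
exchange i j (v , χ) = does (v ≟ j)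
exchange i j (v , ψ) = false

exchange-independent : ∀ {n} (G : LoopedSimpleGraph n) i j →
                       adj G i j ≡ true → Independent G (exchange i j)
exchange-independent {n} G i j adj≡true T T⊆S zero-sum = vanish
  where
  noψ : ∀ v → T (v , ψ) ≡ false
  noψ v = ⊆-false T⊆S (v , ψ) refl
  χ-only-j : ∀ v → v ≢ j → T (v , χ) ≡ false
  χ-only-j v v≢j = ⊆-false T⊆S (v , χ) (dec-false (v ≟ j) v≢j)
  no-iφ : T (i , φ) ≡ false
  no-iφ = ⊆-false T⊆S (i , φ) (cong not (dec-true (i ≟ i) refl))
  at : ∀ u → T (u , φ) xor (T (j , χ) ∧ adj G u j) ≡ false
  at u = begin
    T (u , φ) xor (T (j , χ) ∧ adj G u j)
      ≡⟨ cong (T (u , φ) xor_) (sum-supported _ j (λ v v≢j → cong (_∧ adj G u v) (χ-only-j v v≢j))) ⟨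
    T (u , φ) xor ∑[ v < n ] (T (v , χ) ∧ adj G u v)   ≡⟨ colSum-without-ψ G T noψ u ⟨
    colSum G T u                                       ≡⟨ zero-sum u ⟩
    false                                              ∎
    where open ≡-Reasoning
  no-jχ : T (j , χ) ≡ false
  no-jχ = begin
    T (j , χ)                              ≡⟨ ∧-identityʳ _ ⟨
    T (j , χ) ∧ true                       ≡⟨ cong (T (j , χ) ∧_) adj≡true ⟨
    false xor T (j , χ) ∧ adj G i j        ≡⟨ cong (_xor (T (j , χ) ∧ adj G i j)) no-iφ ⟨
    T (i , φ) xor T (j , χ) ∧ adj G i j    ≡⟨ at i ⟩
    false                                  ∎
    where open ≡-Reasoning
  vanish : ∀ w → T w ≡ false
  vanish (u , φ) = begin
    T (u , φ)                              ≡⟨ xor-identityʳ _ ⟨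
    T (u , φ) xor false ∧ adj G u j        ≡⟨ cong (λ b → T (u , φ) xor b ∧ adj G u j) no-jχ ⟨
    T (u , φ) xor T (j , χ) ∧ adj G u j    ≡⟨ at u ⟩
    false                                  ∎
    where open ≡-Reasoning
  vanish (v , χ) with v ≟ j
  ... | yes refl = no-jχ
  ... | no v≢j   = χ-only-j v v≢j
  vanish (v , ψ) = noψ v

exchange-dependent : ∀ {n} (G : LoopedSimpleGraph n) i j →
                     adj G i j ≡ false → ¬ Independent G (exchange i j)
exchange-dependent {n} G i j adj≡false indep =
  contradiction (trans (sym (dec-true (j ≟ j) refl)) (indep C C⊆exchange C-sum (j , χ))) λ ()
  where
  -- column j of A is the sum of the e_v over the neighbours v of j, none of which is i
  C : Subset (W n)
  C (v , φ) = adj G v j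
  C (v , χ) = does (v ≟ j)
  C (v , ψ) = false
  C⊆exchange : C ⊆ exchange i j
  C⊆exchange (v , φ) adj≡true = cong not (dec-false (v ≟ i) v≢i)
    where
    v≢i : v ≢ i
    v≢i refl = contradiction (trans (sym adj≡true) adj≡false) λ ()
  C⊆exchange (v , χ) Cv = Cv
  C⊆exchange (v , ψ) ()
  C-sum : ∀ u → colSum G C u ≡ false
  C-sum u = begin
    colSum G C u                                    ≡⟨ colSum-without-ψ G C (λ _ → refl) u ⟩
    adj G u j xor ∑[ v < n ] (C (v , χ) ∧ adj G u v) ≡⟨ cong (adj G u j xor_) (sum-supported _ j χ-outside) ⟩
    adj G u j xor (does (j ≟ j) ∧ adj G u j)         ≡⟨ cong (λ b → adj G u j xor (b ∧ adj G u j)) (dec-true (j ≟ j) refl) ⟩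
    adj G u j xor adj G u j                          ≡⟨ xor-same (adj G u j) ⟩
    false                                            ∎
    where
    open ≡-Reasoning
    χ-outside : ∀ v → v ≢ j → C (v , χ) ∧ adj G u v ≡ false
    χ-outside v v≢j = cong (_∧ adj G u v) (dec-false (v ≟ j) v≢j)

exchange-independent⇔adj : ∀ {n} (G : LoopedSimpleGraph n) i j →
                           Independent G (exchange i j) ⇔ adj G i j ≡ true
exchange-independent⇔adj G i j = mk⇔ adjacent (exchange-independent G i j)
  where
  adjacent : Independent G (exchange i j) → adj G i j ≡ true
  adjacent indep with adj G i j in adj≡
  ... | true  = refl
  ... | false = ⊥-elim (exchange-dependent G i j adj≡ indep)

does-≟-injective : ∀ {n₁ n₂} {σ : Fin n₁ → Fin n₂} → Injective _≡_ _≡_ σ →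
                   ∀ a b → does (σ a ≟ σ b) ≡ does (a ≟ b)
does-≟-injective {σ = σ} σ-inj a b with a ≟ b
... | yes refl = dec-true (σ a ≟ σ a) refl
... | no a≢b   = dec-false (σ a ≟ σ b) (a≢b ∘ σ-inj)

exchange-image : ∀ {n₁ n₂} {σ : Fin n₁ → Fin n₂} → Injective _≡_ _≡_ σ →
                 ∀ i j v ι → exchange (σ i) (σ j) (σ v , ι) ≡ exchange i j (v , ι)
exchange-image σ-inj i j v φ = cong not (does-≟-injective σ-inj v i)
exchange-image σ-inj i j v χ = does-≟-injective σ-inj v j
exchange-image σ-inj i j v ψ = refl

module LabelPreserving {n₁ n₂} (β : W n₁ ↔ W n₂) (σ : Fin n₁ → Fin n₂)
                       (β-σ : ∀ v ι → Inverse.to β (v , ι) ≡ (σ v , ι)) where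
  open Inverse β using (from; strictlyInverseˡ; strictlyInverseʳ)

  from-σ : ∀ v ι → from (σ v , ι) ≡ (v , ι)
  from-σ v ι = trans (cong from (sym (β-σ v ι))) (strictlyInverseʳ (v , ι))

  cell-from : ∀ w → (σ (proj₁ (from w)) , proj₂ (from w)) ≡ w
  cell-from w = trans (sym (β-σ _ _)) (strictlyInverseˡ w)

  σ-injective : Injective _≡_ _≡_ σ
  σ-injective {a} {b} σa≡σb =
    cong proj₁ (trans (sym (from-σ a φ)) (trans (cong (λ x → from (x , φ)) σa≡σb) (from-σ b φ)))

  σ-bijection : Fin n₁ ↔ Fin n₂
  σ-bijection = mk↔ₛ′ σ (λ x → proj₁ (from (x , φ)))
    (λ x → cong proj₁ (cell-from (x , φ)))
    (λ v → cong proj₁ (from-σ v φ))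

  from-exchange : ∀ i j → exchange i j ∘ from ≗ exchange (σ i) (σ j)
  from-exchange i j w = begin
    exchange i j (from w)                                           ≡⟨ exchange-image σ-injective i j (proj₁ (from w)) (proj₂ (from w)) ⟨
    exchange (σ i) (σ j) (σ (proj₁ (from w)) , proj₂ (from w))     ≡⟨ cong (exchange (σ i) (σ j)) (cell-from w) ⟩
    exchange (σ i) (σ j) w                                          ∎
    where open ≡-Reasoning

lemma6 : ∀ {n₁ n₂ : ℕ} (G₁ : LoopedSimpleGraph n₁) (G₂ : LoopedSimpleGraph n₂)
           (β : W n₁ ↔ W n₂) (σ : Fin n₁ → Fin n₂) (f : Fin n₁ → S₃) →
           IsMatroidIso G₁ G₂ β →
           IsCompatibleWith β σ f →
           (∀ v ι → f v ⟨$⟩ʳ ι ≡ ι) →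
           Isomorphic G₁ G₂
lemma6 G₁ G₂ β σ f iso compatible f≡1 = σ-bijection , adj-preserved
  where
  open LabelPreserving β σ (λ v ι → trans (compatible v ι) (cong (σ v ,_) (f≡1 v ι)))
  adj-preserved : ∀ i j → adj G₁ i j ≡ adj G₂ (σ i) (σ j)
  adj-preserved i j = ⇔→≡ (
    ⇔.trans (⇔.sym (exchange-independent⇔adj G₁ i j)) (
    ⇔.trans (iso (exchange i j)) (
    ⇔.trans (Independent-cong G₂ (from-exchange i j))
            (exchange-independent⇔adj G₂ (σ i) (σ j)))))
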